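{- Let $\mathfrak{S}$ be a board and $I,J\subseteq\mathfrak{S}$, and assume one can go from $I$ to $J$ by a succession of legal moves. Then there exist non-negative integers $x(\mathfrak{g})$ ($\mathfrak{g}\in\mathscr{D}(\mathfrak{S})$) and $y_{\mathfrak{g}}(A)$ ($\mathfrak{g}\in\mathscr{D}(\mathfrak{S})$, $A\in\mathfrak{S}$, with $y_{\mathfrak{g}}(A)=0$ whenever $\mathfrak{g}(A)\neq0$) such that $$\mathbf{1}_I\boxtimes\mathbf{1}_I-\mathbf{1}_J\boxtimes\mathbf{1}_J=\sum_{\mathfrak{g}}x(\mathfrak{g})\,|\mathfrak{g}|\boxtimes\mathfrak{g}+\sum_{\mathfrak{g}}\sum_{A}y_{\mathfrak{g}}(A)\,2[A]\boxtimes\mathfrak{g}$$ and, for every $A\in\mathfrak{S}$, $$0\le\sum_{\mathfrak{g}}y_{\mathfrak{g}}(A)+\sum_{\mathfrak{g}:\,\mathfrak{g}(A)\neq0}x(\mathfrak{g})\le|I|-|J|.$$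
   Context: A board $\mathfrak{S}$ is a finite subset of $\mathbb{Z}^2$; $[P]$ is the function on $\mathfrak{S}$ equal to $1$ at $P$ and $0$ elsewhere, and $\mathbf{1}_I$ the indicator of $I$. The set of moves $\mathscr{D}(\mathfrak{S})$ consists of all functions $\mathfrak{g}=[P]+[Q]-[R]$ with $P,Q,R\in\mathfrak{S}$, $Q=P+v$, $R=P+2v$ for some $v\in\{(\pm1,0),(0,\pm1)\}$; $|\mathfrak{g}|=[P]+[Q]+[R]$. A position is a subset $K\subseteq\mathfrak{S}$; a legal move $\mathfrak{g}=[P]+[Q]-[R]$ goes from $K$ to $K'$ if $P,Q\in K$, $R\notin K$ and $\mathbf{1}_{K'}=\mathbf{1}_K-\mathfrak{g}$. $\mathfrak{S}\boxtimes\mathfrak{S}$ is the set of unordered pairs $A\boxtimes B=B\boxtimes A$ ($A,B\in\mathfrak{S}$, possibly equal); for functions $g_1,g_2$ on $\mathfrak{S}$, $g_1\boxtimes g_2$ is the function on $\mathfrak{S}\boxtimes\mathfrak{S}$ with value $g_1(A)g_2(B)+g_1(B)g_2(A)$ at $A\boxtimes B$ if $A\neq B$ and $g_1(A)g_2(A)$ if $A=B$. -}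

module Defs where

open import Data.Bool using (Bool; true; false; if_then_else_)
open import Data.Nat using (ℕ)
open import Data.Integer using (ℤ; +_; _+_; _-_; _*_; 0ℤ; 1ℤ; _≟_)
open import Data.Product using (Σ; _×_; _,_)
open import Data.Product.Properties using (≡-dec)
open import Data.List using (List; []; _∷_; foldr; map)
open import Data.List.Relation.Unary.Unique.Propositional using (Unique)
open import Relation.Binary.Definitions using (DecidableEquality)
open import Relation.Binary.PropositionalEquality using (_≡_)
open import Relation.Nullary using (Dec; does; ¬_)
open import Relation.Nullary.Decidable using (_×-dec_)

Point : Set
Point = ℤ × ℤ

_≟P_ : DecidableEquality Point
_≟P_ = ≡-dec _≟_ _≟_

open import Data.List.Membership.DecPropositional _≟P_ public using (_∈_; _∈?_)

record Board : Set where
  field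
    pts  : List Point
    uniq : Unique pts
open Board public

_⊕_ : Point → Point → Point
(a , b) ⊕ (c , d) = (a + c , b + d)

data Dir : Set where
  right left up down : Dir

dirs : List Dir
dirs = right ∷ left ∷ up ∷ down ∷ []

vec : Dir → Point
vec right = (+ 1 , 0ℤ)
vec left  = (Data.Integer.-_ (+ 1) , 0ℤ)
vec up    = (0ℤ , + 1)
vec down  = (0ℤ , Data.Integer.-_ (+ 1))

-- For a move g = [P]+[Q]-[R] given by P and direction v: Q = P+v, R = P+2v.
Qpt : Point → Dir → Point
Qpt P d = P ⊕ vec d

Rpt : Point → Dir → Point
Rpt P d = (P ⊕ vec d) ⊕ vec d

-- (P , v) describes a move of 𝒟(𝔖) iff P, Q, R ∈ 𝔖.
-- (The map (P,v) ↦ [P]+[Q]-[R] is injective, so moves are indexed by such pairs.)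
IsMove : Board → Point → Dir → Set
IsMove S P d = (P ∈ pts S) × (Qpt P d ∈ pts S) × (Rpt P d ∈ pts S)

isMove? : (S : Board) → (P : Point) → (d : Dir) → Dec (IsMove S P d)
isMove? S P d = (P ∈? pts S) ×-dec ((Qpt P d ∈? pts S) ×-dec (Rpt P d ∈? pts S))

-- functions on the board (only their values on 𝔖 matter)
Fun : Set
Fun = Point → ℤ

δ : Point → Fun
δ P A = if does (A ≟P P) then 1ℤ else 0ℤ

gfun : Point → Dir → Fun
gfun P d A = (δ P A + δ (Qpt P d) A) - δ (Rpt P d) A

absg : Point → Dir → Fun
absg P d A = (δ P A + δ (Qpt P d) A) + δ (Rpt P d) A

-- g₁ ⊠ g₂ evaluated at the unordered pair A ⊠ B
_⊠_ : Fun → Fun → Point → Point → ℤ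
(g₁ ⊠ g₂) A B =
  if does (A ≟P B) then g₁ A * g₂ A else (g₁ A * g₂ B + g₁ B * g₂ A)

sumℤ : List ℤ → ℤ
sumℤ = foldr _+_ 0ℤ

sumPts : Board → (Point → ℤ) → ℤ
sumPts S f = sumℤ (map f (pts S))

sumMoves : Board → (Point → Dir → ℤ) → ℤ
sumMoves S f =
  sumPts S (λ P → sumℤ (map (λ d → if does (isMove? S P d) then f P d else 0ℤ) dirs))

Position : Set
Position = Point → Bool

_⊆B_ : Position → Board → Set
K ⊆B S = ∀ A → K A ≡ true → A ∈ pts S

ind : Position → Fun
ind K A = if K A then 1ℤ else 0ℤ

card : Board → Position → ℤ
card S K = sumPts S (ind K)

LegalMove : Board → Position → Position → Set
LegalMove S K K' =
  Σ Point λ P → Σ Dir λ d →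
    IsMove S P d × K P ≡ true × K (Qpt P d) ≡ true × K (Rpt P d) ≡ false ×
    K' ⊆B S × (∀ A → A ∈ pts S → ind K' A ≡ ind K A - gfun P d A)

data Reach (S : Board) : Position → Position → Set where
  done : ∀ {K} → Reach S K K
  step : ∀ {K K' K''} → LegalMove S K K' → Reach S K' K'' → Reach S K K''

module Submission where

-- A certificate for a passage K ⇝ L is a pair of coefficient
-- families (x , y) with y_g vanishing on the support of g, the identity
--   𝟏_K ⊠ 𝟏_K − 𝟏_L ⊠ 𝟏_L = Σ_g x(g) |g| ⊠ g + Σ_g Σ_C y_g(C) 2[C] ⊠ g
-- on 𝔖 ⊠ 𝔖, and load Σ_g y_g(A) + Σ_{g(A) ≠ 0} x(g) ≤ |K| − |L| at every A.
-- Both sides of the identity and the load are additive in (x , y) and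
-- |K| − |L| telescopes, so certificates compose along a path of moves.
-- For one legal move g = [P]+[Q]−[R] from K to K − g, write 𝟏_K = c + [P] + [Q]
-- with c = 𝟏_{K∖{P,Q}}; bilinearity and symmetry of ⊠ give
--   𝟏_K ⊠ 𝟏_K − (𝟏_K − g) ⊠ (𝟏_K − g) = (2·𝟏_K − g) ⊠ g = |g| ⊠ g + 2c ⊠ g,
-- so x = [g], y_g = c is a certificate: c vanishes on {P, Q, R} since R ∉ K,
-- the load is c(A) + [g(A) ≠ 0] ≤ 1 and |K| − |K − g| = Σ g = 1.
-- The file develops finite sums, sums over moves and the algebra of ⊠, then
-- certificates; the theorem follows by induction on the sequence of moves.

open import Defs
open import Algebra.Bundles using (AbelianGroup)
open import Data.Bool using (true; false; if_then_else_; _∧_; not)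
open import Data.Bool.Properties using (∧-zeroʳ)
open import Data.Nat as ℕ using (ℕ)
open import Data.Integer using (ℤ; +_; _+_; _-_; _*_; _≤_; +≤+; 0ℤ; 1ℤ; _≟_)
open import Data.Integer.Properties as ℤP using ()
open import Data.Integer.Tactic.RingSolver using (solve-∀)
open import Data.Empty using (⊥-elim)
open import Data.Product using (Σ; _×_; _,_; proj₁; proj₂)
open import Data.List using (List; []; _∷_; map)
open import Data.List.Relation.Unary.All as All using (All; []; _∷_)
open import Data.List.Relation.Unary.AllPairs using ([]; _∷_)
open import Data.List.Relation.Unary.Any using (Any; here; there)
open import Data.List.Relation.Unary.Unique.Propositional using (Unique)
open import Relation.Binary.Definitions using (DecidableEquality)
open import Relation.Binary.PropositionalEquality
  using (_≡_; _≢_; refl; sym; trans; cong; cong₂; module ≡-Reasoning)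
open import Relation.Nullary using (does; ¬_; yes; no)
open import Relation.Nullary.Decidable using (dec-true; dec-false)
open import Algebra.Properties.Group (AbelianGroup.group ℤP.+-0-abelianGroup)
  using (identityʳ-unique)

-- Finite sums over lists

interchange : ∀ a b u v → (a + b) + (u + v) ≡ (a + u) + (b + v)
interchange = solve-∀

sumL : {X : Set} → List X → (X → ℤ) → ℤ
sumL l f = sumℤ (map f l)

sum-cong : {X : Set} (l : List X) {f g : X → ℤ} →
  (∀ c → Any (c ≡_) l → f c ≡ g c) → sumL l f ≡ sumL l g
sum-cong []      h = refl
sum-cong (c ∷ l) h = cong₂ _+_ (h c (here refl)) (sum-cong l (λ c' m → h c' (there m)))

sum-zero : {X : Set} (l : List X) {f : X → ℤ} → All (λ c → f c ≡ 0ℤ) l → sumL l f ≡ 0ℤ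
sum-zero []      []         = refl
sum-zero (c ∷ l) (fc ∷ fcs) = cong₂ _+_ fc (sum-zero l fcs)

sum-+ : {X : Set} (l : List X) (f g : X → ℤ) →
  sumL l (λ c → f c + g c) ≡ sumL l f + sumL l g
sum-+ []      f g = refl
sum-+ (c ∷ l) f g = trans (cong (_+_ (f c + g c)) (sum-+ l f g)) (interchange (f c) (g c) (sumL l f) (sumL l g))

sum-- : {X : Set} (l : List X) (f g : X → ℤ) →
  sumL l (λ c → f c - g c) ≡ sumL l f - sumL l g
sum-- []      f g = refl
sum-- (c ∷ l) f g = trans (cong (_+_ (f c - g c)) (sum-- l f g)) (regroup (f c) (g c) (sumL l f) (sumL l g))
  where
  regroup : ∀ a b u v → a - b + (u - v) ≡ a + u - (b + v)
  regroup = solve-∀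

sum-nonneg : {X : Set} (l : List X) {f : X → ℤ} → (∀ c → 0ℤ ≤ f c) → 0ℤ ≤ sumL l f
sum-nonneg []      h = ℤP.≤-refl
sum-nonneg (c ∷ l) h = ℤP.+-mono-≤ (h c) (sum-nonneg l h)

sum-single : {X : Set} (l : List X) (f : X → ℤ) {a : X} → Unique l → Any (a ≡_) l →
  (∀ c → c ≢ a → f c ≡ 0ℤ) → sumL l f ≡ f a
sum-single (c ∷ l) f (c∉l ∷ _) (here refl) off =
  trans (cong (_+_ (f c)) (sum-zero l (All.map (λ c≢c' → off _ (λ e → c≢c' (sym e))) c∉l)))
        (ℤP.+-identityʳ (f c))
sum-single (c ∷ l) f (c∉l ∷ u) (there a∈l) off =
  trans (cong₂ _+_ (off c (λ e → All.lookup c∉l a∈l e)) (sum-single l f u a∈l off))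
        (ℤP.+-identityˡ _)

δ-self : ∀ X → δ X X ≡ 1ℤ
δ-self X rewrite dec-true (X ≟P X) refl = refl

δ-other : ∀ X A → A ≢ X → δ X A ≡ 0ℤ
δ-other X A A≢X rewrite dec-false (A ≟P X) A≢X = refl

sum-δ : (S : Board) {X : Point} → X ∈ pts S → sumPts S (δ X) ≡ 1ℤ
sum-δ S {X} X∈S = trans (sum-single (pts S) (δ X) (uniq S) X∈S (δ-other X)) (δ-self X)

sum-pick : (S : Board) (h : Point → ℤ) {E : Point} → E ∈ pts S →
  sumPts S (λ C → h C * δ C E) ≡ h E
sum-pick S h {E} E∈S =
  trans (sum-single (pts S) (λ C → h C * δ C E) (uniq S) E∈S
          (λ C C≢E → trans (cong (h C *_) (δ-other C E (λ e → C≢E (sym e)))) (ℤP.*-zeroʳ (h C))))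
        (trans (cong (h E *_) (δ-self E)) (ℤP.*-identityʳ (h E)))

-- Sums over the moves 𝒟(𝔖)

_≟D_ : DecidableEquality Dir
right ≟D right = yes refl
right ≟D left  = no λ ()
right ≟D up    = no λ ()
right ≟D down  = no λ ()
left  ≟D right = no λ ()
left  ≟D left  = yes refl
left  ≟D up    = no λ ()
left  ≟D down  = no λ ()
up    ≟D right = no λ ()
up    ≟D left  = no λ ()
up    ≟D up    = yes refl
up    ≟D down  = no λ ()
down  ≟D right = no λ ()
down  ≟D left  = no λ ()
down  ≟D up    = no λ ()
down  ≟D down  = yes refl

dirs-unique : Unique dirs
dirs-unique = ((λ ()) ∷ (λ ()) ∷ (λ ()) ∷ []) ∷ ((λ ()) ∷ (λ ()) ∷ []) ∷ ((λ ()) ∷ []) ∷ [] ∷ []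

dir∈dirs : (d : Dir) → Any (d ≡_) dirs
dir∈dirs right = here refl
dir∈dirs left  = there (here refl)
dir∈dirs up    = there (there (here refl))
dir∈dirs down  = there (there (there (here refl)))

onMoves : Board → (Point → Dir → ℤ) → Point → Dir → ℤ
onMoves S F P d = if does (isMove? S P d) then F P d else 0ℤ

onMoves-move : ∀ S F {P d} → IsMove S P d → onMoves S F P d ≡ F P d
onMoves-move S F {P} {d} mv rewrite dec-true (isMove? S P d) mv = refl

onMoves-non-move : ∀ S F {P d} → ¬ IsMove S P d → onMoves S F P d ≡ 0ℤ
onMoves-non-move S F {P} {d} ¬mv rewrite dec-false (isMove? S P d) ¬mv = refl

sumMoves-cong : (S : Board) {F G : Point → Dir → ℤ} →
  (∀ P d → IsMove S P d → F P d ≡ G P d) → sumMoves S F ≡ sumMoves S G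
sumMoves-cong S {F} {G} F≡G = sum-cong (pts S) λ P _ → sum-cong dirs λ d _ → restricted P d
  where
  restricted : ∀ P d → onMoves S F P d ≡ onMoves S G P d
  restricted P d with isMove? S P d
  ... | yes mv = trans (onMoves-move S F mv) (trans (F≡G P d mv) (sym (onMoves-move S G mv)))
  ... | no ¬mv = trans (onMoves-non-move S F ¬mv) (sym (onMoves-non-move S G ¬mv))

sumMoves-zero : (S : Board) {F : Point → Dir → ℤ} →
  (∀ P d → IsMove S P d → F P d ≡ 0ℤ) → sumMoves S F ≡ 0ℤ
sumMoves-zero S {F} F≡0 =
  sum-zero (pts S) (All.universal (λ P → sum-zero dirs (All.universal (restricted P) dirs)) (pts S))
  where
  restricted : ∀ P d → onMoves S F P d ≡ 0ℤ
  restricted P d with isMove? S P d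
  ... | yes mv = trans (onMoves-move S F mv) (F≡0 P d mv)
  ... | no ¬mv = onMoves-non-move S F ¬mv

sumMoves-+ : (S : Board) (F G : Point → Dir → ℤ) →
  sumMoves S (λ P d → F P d + G P d) ≡ sumMoves S F + sumMoves S G
sumMoves-+ S F G =
  trans (sum-cong (pts S) λ P _ →
           trans (sum-cong dirs λ d _ → restricted P d) (sum-+ dirs (onMoves S F P) (onMoves S G P)))
        (sum-+ (pts S) _ _)
  where
  restricted : ∀ P d → onMoves S (λ P' d' → F P' d' + G P' d') P d ≡ onMoves S F P d + onMoves S G P d
  restricted P d with does (isMove? S P d)
  ... | true  = refl
  ... | false = refl

sumMoves-nonneg : (S : Board) {F : Point → Dir → ℤ} → (∀ P d → 0ℤ ≤ F P d) → 0ℤ ≤ sumMoves S F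
sumMoves-nonneg S {F} 0≤F = sum-nonneg (pts S) λ P → sum-nonneg dirs (restricted P)
  where
  restricted : ∀ P d → 0ℤ ≤ onMoves S F P d
  restricted P d with does (isMove? S P d)
  ... | true  = 0≤F P d
  ... | false = ℤP.≤-refl

sumMoves-single : (S : Board) (P : Point) (d : Dir) → IsMove S P d → (F : Point → Dir → ℤ) →
  (∀ P' d' → ¬ (P' ≡ P × d' ≡ d) → F P' d' ≡ 0ℤ) → sumMoves S F ≡ F P d
sumMoves-single S P d mv F off =
  trans (sum-single (pts S) _ (uniq S) (proj₁ mv)
          (λ P' P'≢P → sum-zero dirs (All.universal (λ d' → off-move P' d' (λ e → P'≢P (proj₁ e))) dirs)))
        (trans (sum-single dirs _ dirs-unique (dir∈dirs d) (λ d' d'≢d → off-move P d' (λ e → d'≢d (proj₂ e))))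
               (onMoves-move S F mv))
  where
  off-move : ∀ P' d' → ¬ (P' ≡ P × d' ≡ d) → onMoves S F P' d' ≡ 0ℤ
  off-move P' d' ne with does (isMove? S P' d')
  ... | true  = off P' d' ne
  ... | false = refl

atMove : Point → Dir → ℕ → Point → Dir → ℕ
atMove P d n P' d' = if does (P' ≟P P) ∧ does (d' ≟D d) then n else 0

atMove-at : ∀ P d n → atMove P d n P d ≡ n
atMove-at P d n rewrite dec-true (P ≟P P) refl | dec-true (d ≟D d) refl = refl

atMove-off : ∀ P d n P' d' → ¬ (P' ≡ P × d' ≡ d) → atMove P d n P' d' ≡ 0
atMove-off P d n P' d' ne with P' ≟P P | d' ≟D d
... | yes e₁ | yes e₂ = ⊥-elim (ne (e₁ , e₂))
... | yes _  | no _   = refl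
... | no _   | _      = refl

-- The product ⊠ is bilinear; we use linearity in the first argument.

⊠-cong : ∀ {f f' g g' : Fun} A B → f A ≡ f' A → f B ≡ f' B → g A ≡ g' A → g B ≡ g' B →
  (f ⊠ g) A B ≡ (f' ⊠ g') A B
⊠-cong A B fA fB gA gB with A ≟P B
... | yes _ = cong₂ _*_ fA gA
... | no _  = cong₂ _+_ (cong₂ _*_ fA gB) (cong₂ _*_ fB gA)

⊠-zeroˡ : ∀ (g : Fun) A B → ((λ _ → 0ℤ) ⊠ g) A B ≡ 0ℤ
⊠-zeroˡ g A B with A ≟P B
... | yes _ = refl
... | no _  = refl

⊠-+ˡ : ∀ (u v g : Fun) A B → ((λ E → u E + v E) ⊠ g) A B ≡ (u ⊠ g) A B + (v ⊠ g) A B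
⊠-+ˡ u v g A B with A ≟P B
... | yes _ = ℤP.*-distribʳ-+ (g A) (u A) (v A)
... | no _  = different (u A) (u B) (v A) (v B) (g A) (g B)
  where
  different : ∀ uA uB vA vB gA gB →
    (uA + vA) * gB + (uB + vB) * gA ≡ (uA * gB + uB * gA) + (vA * gB + vB * gA)
  different = solve-∀

⊠-scaleˡ : ∀ (a : ℤ) (u g : Fun) A B → ((λ E → a * u E) ⊠ g) A B ≡ a * (u ⊠ g) A B
⊠-scaleˡ a u g A B with A ≟P B
... | yes _ = ℤP.*-assoc a (u A) (g A)
... | no _  = different a (u A) (u B) (g A) (g B)
  where
  different : ∀ a uA uB gA gB → a * uA * gB + a * uB * gA ≡ a * (uA * gB + uB * gA)
  different = solve-∀

⊠-sumˡ : {X : Set} (l : List X) (k : X → ℤ) (f : X → Fun) (g : Fun) (A B : Point) →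
  sumL l (λ C → k C * (f C ⊠ g) A B) ≡ ((λ E → sumL l (λ C → k C * f C E)) ⊠ g) A B
⊠-sumˡ []      k f g A B = sym (⊠-zeroˡ g A B)
⊠-sumˡ (C ∷ l) k f g A B =
  trans (cong₂ _+_ (sym (⊠-scaleˡ (k C) (f C) g A B)) (⊠-sumˡ l k f g A B))
        (sym (⊠-+ˡ (λ E → k C * f C E) (λ E → sumL l (λ C' → k C' * f C' E)) g A B))

⊠-square-difference : ∀ (f g : Fun) A B →
  (f ⊠ f) A B - ((λ E → f E - g E) ⊠ (λ E → f E - g E)) A B ≡ ((λ E → + 2 * f E - g E) ⊠ g) A B
⊠-square-difference f g A B with A ≟P B
... | yes _ = same (f A) (g A)
  where
  same : ∀ f g → f * f - (f - g) * (f - g) ≡ (+ 2 * f - g) * g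
  same = solve-∀
... | no _  = different (f A) (f B) (g A) (g B)
  where
  different : ∀ fA fB gA gB →
    fA * fB + fB * fA - ((fA - gA) * (fB - gB) + (fB - gB) * (fA - gA))
      ≡ (+ 2 * fA - gA) * gB + (+ 2 * fB - gB) * gA
  different = solve-∀

-- Geometry of a single move

vec≢0 : ∀ d → vec d ≢ (0ℤ , 0ℤ)
vec≢0 right ()
vec≢0 left  ()
vec≢0 up    ()
vec≢0 down  ()

P≢Q : ∀ P d → P ≢ Qpt P d
P≢Q (a , b) d P≡Q = vec≢0 d (cong₂ _,_ (identityʳ-unique a _ (sym (cong proj₁ P≡Q)))
                                       (identityʳ-unique b _ (sym (cong proj₂ P≡Q))))

sum-gfun : (S : Board) (P : Point) (d : Dir) → IsMove S P d → sumPts S (gfun P d) ≡ 1ℤ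
sum-gfun S P d (P∈S , Q∈S , R∈S) = begin
    sumPts S (gfun P d)
  ≡⟨ sum-- (pts S) (λ A → δ P A + δ (Qpt P d) A) (δ (Rpt P d)) ⟩
    sumPts S (λ A → δ P A + δ (Qpt P d) A) - sumPts S (δ (Rpt P d))
  ≡⟨ cong (_- sumPts S (δ (Rpt P d))) (sum-+ (pts S) (δ P) (δ (Qpt P d))) ⟩
    sumPts S (δ P) + sumPts S (δ (Qpt P d)) - sumPts S (δ (Rpt P d))
  ≡⟨ cong₂ _-_ (cong₂ _+_ (sum-δ S P∈S) (sum-δ S Q∈S)) (sum-δ S R∈S) ⟩
    1ℤ ∎
  where open ≡-Reasoning

card-difference : (S : Board) (K K' : Position) (h : Fun) →
  (∀ A → A ∈ pts S → ind K' A ≡ ind K A - h A) → card S K - card S K' ≡ sumPts S h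
card-difference S K K' h K'≡K-h = begin
    card S K - card S K'
  ≡⟨ cong (_-_ (card S K)) (trans (sum-cong (pts S) K'≡K-h) (sum-- (pts S) (ind K) h)) ⟩
    card S K - (card S K - sumPts S h)
  ≡⟨ cancel (card S K) (sumPts S h) ⟩
    sumPts S h ∎
  where
  open ≡-Reasoning
  cancel : ∀ k s → k - (k - s) ≡ s
  cancel = solve-∀

-- Certificates

indℕ : Position → Point → ℕ
indℕ K A = if K A then 1 else 0

+indℕ : ∀ K A → + indℕ K A ≡ ind K A
+indℕ K A with K A
... | true  = refl
... | false = refl

Combination : Board → (Point → Dir → ℕ) → (Point → Dir → Point → ℕ) → Point → Point → ℤ
Combination S x y A B =
  sumMoves S (λ P d → + x P d * (absg P d ⊠ gfun P d) A B)
  + sumMoves S (λ P d → sumPts S (λ C → + y P d C * ((λ E → + 2 * δ C E) ⊠ gfun P d) A B))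

Load : Board → (Point → Dir → ℕ) → (Point → Dir → Point → ℕ) → Point → ℤ
Load S x y A =
  sumMoves S (λ P d → + y P d A)
  + sumMoves S (λ P d → if does (gfun P d A ≟ 0ℤ) then 0ℤ else + x P d)

-- A certificate for the passage K ⇝ L: the conclusion of the theorem for the
-- pair (K , L), apart from the lower bound 0 ≤ load, which always holds.
record Certificate (S : Board) (K L : Position) : Set where
  field
    x          : Point → Dir → ℕ
    y          : Point → Dir → Point → ℕ
    y-support  : ∀ P d A → IsMove S P d → A ∈ pts S → gfun P d A ≢ 0ℤ → y P d A ≡ 0
    identity   : ∀ A B → A ∈ pts S → B ∈ pts S →
                 (ind K ⊠ ind K) A B - (ind L ⊠ ind L) A B ≡ Combination S x y A B
    load-bound : ∀ A → A ∈ pts S → Load S x y A ≤ card S K - card S L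

Load-nonneg : ∀ S x y A → 0ℤ ≤ Load S x y A
Load-nonneg S x y A =
  ℤP.+-mono-≤ (sumMoves-nonneg S {λ P d → + y P d A} (λ _ _ → +≤+ ℕ.z≤n)) (sumMoves-nonneg S nonneg)
  where
  nonneg : ∀ P d → 0ℤ ≤ (if does (gfun P d A ≟ 0ℤ) then 0ℤ else + x P d)
  nonneg P d with does (gfun P d A ≟ 0ℤ)
  ... | true  = ℤP.≤-refl
  ... | false = +≤+ ℕ.z≤n

weights-+ : ∀ m n h → + (m ℕ.+ n) * h ≡ + m * h + + n * h
weights-+ m n h = trans (cong (_* h) (ℤP.pos-+ m n)) (ℤP.*-distribʳ-+ h (+ m) (+ n))

Combination-+ : ∀ S x₁ y₁ x₂ y₂ A B →
  Combination S (λ P d → x₁ P d ℕ.+ x₂ P d) (λ P d C → y₁ P d C ℕ.+ y₂ P d C) A B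
    ≡ Combination S x₁ y₁ A B + Combination S x₂ y₂ A B
Combination-+ S x₁ y₁ x₂ y₂ A B =
  trans (cong₂ _+_ x-part y-part) (interchange (X x₁) (X x₂) (Y y₁) (Y y₂))
  where
  H : Point → Dir → ℤ
  H P d = (absg P d ⊠ gfun P d) A B
  G : Point → Dir → Point → ℤ
  G P d C = ((λ E → + 2 * δ C E) ⊠ gfun P d) A B
  X : (Point → Dir → ℕ) → ℤ
  X x = sumMoves S (λ P d → + x P d * H P d)
  Y : (Point → Dir → Point → ℕ) → ℤ
  Y y = sumMoves S (λ P d → sumPts S (λ C → + y P d C * G P d C))
  x-part : X (λ P d → x₁ P d ℕ.+ x₂ P d) ≡ X x₁ + X x₂
  x-part = trans (sumMoves-cong S λ P d _ → weights-+ (x₁ P d) (x₂ P d) (H P d))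
                 (sumMoves-+ S (λ P d → + x₁ P d * H P d) (λ P d → + x₂ P d * H P d))
  y-part : Y (λ P d C → y₁ P d C ℕ.+ y₂ P d C) ≡ Y y₁ + Y y₂
  y-part = trans (sumMoves-cong S λ P d _ →
                    trans (sum-cong (pts S) λ C _ → weights-+ (y₁ P d C) (y₂ P d C) (G P d C))
                          (sum-+ (pts S) (λ C → + y₁ P d C * G P d C) (λ C → + y₂ P d C * G P d C)))
                 (sumMoves-+ S (λ P d → sumPts S (λ C → + y₁ P d C * G P d C))
                               (λ P d → sumPts S (λ C → + y₂ P d C * G P d C)))

Load-+ : ∀ S x₁ y₁ x₂ y₂ A →
  Load S (λ P d → x₁ P d ℕ.+ x₂ P d) (λ P d C → y₁ P d C ℕ.+ y₂ P d C) A
    ≡ Load S x₁ y₁ A + Load S x₂ y₂ A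
Load-+ S x₁ y₁ x₂ y₂ A =
  trans (cong₂ _+_ y-part x-part) (interchange (Y y₁) (Y y₂) (X x₁) (X x₂))
  where
  counted : (Point → Dir → ℕ) → Point → Dir → ℤ
  counted x P d = if does (gfun P d A ≟ 0ℤ) then 0ℤ else + x P d
  X : (Point → Dir → ℕ) → ℤ
  X x = sumMoves S (counted x)
  Y : (Point → Dir → Point → ℕ) → ℤ
  Y y = sumMoves S (λ P d → + y P d A)
  counted-+ : ∀ P d → counted (λ P' d' → x₁ P' d' ℕ.+ x₂ P' d') P d ≡ counted x₁ P d + counted x₂ P d
  counted-+ P d with does (gfun P d A ≟ 0ℤ)
  ... | true  = refl
  ... | false = ℤP.pos-+ (x₁ P d) (x₂ P d)
  x-part : X (λ P d → x₁ P d ℕ.+ x₂ P d) ≡ X x₁ + X x₂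
  x-part = trans (sumMoves-cong S λ P d _ → counted-+ P d) (sumMoves-+ S (counted x₁) (counted x₂))
  y-part : Y (λ P d C → y₁ P d C ℕ.+ y₂ P d C) ≡ Y y₁ + Y y₂
  y-part = trans (sumMoves-cong S λ P d _ → ℤP.pos-+ (y₁ P d A) (y₂ P d A))
                 (sumMoves-+ S (λ P d → + y₁ P d A) (λ P d → + y₂ P d A))

certificate-refl : ∀ S K → Certificate S K K
certificate-refl S K = record
  { x          = λ _ _ → 0
  ; y          = λ _ _ _ → 0
  ; y-support  = λ _ _ _ _ _ _ → refl
  ; identity   = λ A B _ _ → trans (ℤP.+-inverseʳ ((ind K ⊠ ind K) A B)) (sym (zero-combination A B))
  ; load-bound = λ A _ → ℤP.≤-reflexive (trans (zero-load A) (sym (ℤP.+-inverseʳ (card S K))))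
  }
  where
  zero-combination : ∀ A B → Combination S (λ _ _ → 0) (λ _ _ _ → 0) A B ≡ 0ℤ
  zero-combination A B =
    cong₂ _+_ (sumMoves-zero S λ _ _ _ → refl)
              (sumMoves-zero S λ _ _ _ → sum-zero (pts S) (All.universal (λ _ → refl) (pts S)))
  zero-load : ∀ A → Load S (λ _ _ → 0) (λ _ _ _ → 0) A ≡ 0ℤ
  zero-load A = cong₂ _+_ (sumMoves-zero S λ _ _ _ → refl) (sumMoves-zero S λ P d _ → uncounted P d)
    where
    uncounted : ∀ P d → (if does (gfun P d A ≟ 0ℤ) then 0ℤ else + 0) ≡ 0ℤ
    uncounted P d with does (gfun P d A ≟ 0ℤ)
    ... | true  = refl
    ... | false = refl

certificate-trans : ∀ {S K K' L} → Certificate S K K' → Certificate S K' L → Certificate S K L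
certificate-trans {S} {K} {K'} {L} c₁ c₂ = record
  { x          = λ P d → C₁.x P d ℕ.+ C₂.x P d
  ; y          = λ P d C → C₁.y P d C ℕ.+ C₂.y P d C
  ; y-support  = λ P d A mv A∈S g≢0 →
                   cong₂ ℕ._+_ (C₁.y-support P d A mv A∈S g≢0) (C₂.y-support P d A mv A∈S g≢0)
  ; identity   = λ A B A∈S B∈S → begin
      (ind K ⊠ ind K) A B - (ind L ⊠ ind L) A B
    ≡⟨ telescope ((ind K ⊠ ind K) A B) ((ind K' ⊠ ind K') A B) ((ind L ⊠ ind L) A B) ⟩
      ((ind K ⊠ ind K) A B - (ind K' ⊠ ind K') A B) + ((ind K' ⊠ ind K') A B - (ind L ⊠ ind L) A B)
    ≡⟨ cong₂ _+_ (C₁.identity A B A∈S B∈S) (C₂.identity A B A∈S B∈S) ⟩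
      Combination S C₁.x C₁.y A B + Combination S C₂.x C₂.y A B
    ≡⟨ sym (Combination-+ S C₁.x C₁.y C₂.x C₂.y A B) ⟩
      _ ∎
  ; load-bound = λ A A∈S → ℤP.≤-trans
      (ℤP.≤-reflexive (Load-+ S C₁.x C₁.y C₂.x C₂.y A))
      (ℤP.≤-trans (ℤP.+-mono-≤ (C₁.load-bound A A∈S) (C₂.load-bound A A∈S))
                  (ℤP.≤-reflexive (sym (telescope (card S K) (card S K') (card S L)))))
  }
  where
  module C₁ = Certificate c₁
  module C₂ = Certificate c₂
  open ≡-Reasoning
  telescope : ∀ a b c → a - c ≡ (a - b) + (b - c)
  telescope = solve-∀

module SingleMove (S : Board) (K K' : Position) (P : Point) (d : Dir) (mv : IsMove S P d)
  (KP : K P ≡ true) (KQ : K (Qpt P d) ≡ true) (KR : K (Rpt P d) ≡ false)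
  (K'≡K-g : ∀ A → A ∈ pts S → ind K' A ≡ ind K A - gfun P d A) where

  Q R : Point
  Q = Qpt P d
  R = Rpt P d

  rest : Position
  rest E = K E ∧ not (does (E ≟P P)) ∧ not (does (E ≟P Q))

  ind-split : ∀ E → ind K E ≡ ind rest E + δ P E + δ Q E
  ind-split E with E ≟P P | E ≟P Q
  ... | yes refl | yes P≡Q = ⊥-elim (P≢Q P d P≡Q)
  ... | yes refl | no _    rewrite KP = refl
  ... | no _     | yes refl rewrite KQ = refl
  ... | no _     | no _    with K E
  ...   | true  = refl
  ...   | false = refl

  -- rest avoids the support {P, Q, R} of g (R ∉ K because the move is legal).
  rest-off-support : ∀ E → gfun P d E ≢ 0ℤ → rest E ≡ false
  rest-off-support E g≢0 with E ≟P P | E ≟P Q | E ≟P R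
  ... | yes _ | _     | _     = ∧-zeroʳ (K E)
  ... | no _  | yes _ | _     = ∧-zeroʳ (K E)
  rest-off-support E g≢0 | no _ | no _ | yes refl rewrite KR = refl
  rest-off-support E g≢0 | no _ | no _ | no _ = ⊥-elim (g≢0 refl)

  weight-split : ∀ E → + 2 * ind K E - gfun P d E ≡ absg P d E + + 2 * ind rest E
  weight-split E = trans (cong (λ k → + 2 * k - gfun P d E) (ind-split E))
                         (regroup (ind rest E) (δ P E) (δ Q E) (δ R E))
    where
    regroup : ∀ c p q r → + 2 * (c + p + q) - (p + q - r) ≡ (p + q + r) + + 2 * c
    regroup = solve-∀

  x : Point → Dir → ℕ
  x = atMove P d 1

  y : Point → Dir → Point → ℕ
  y P' d' C = atMove P d (indℕ rest C) P' d'

  y-support : ∀ P' d' A → IsMove S P' d' → A ∈ pts S → gfun P' d' A ≢ 0ℤ → y P' d' A ≡ 0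
  y-support P' d' A _ _ g≢0 with P' ≟P P | d' ≟D d
  ... | yes refl | yes refl = cong (λ b → if b then 1 else 0) (rest-off-support A g≢0)
  ... | yes _    | no _     = refl
  ... | no _     | _        = refl

  x-contribution : ∀ A B →
    sumMoves S (λ P' d' → + x P' d' * (absg P' d' ⊠ gfun P' d') A B) ≡ (absg P d ⊠ gfun P d) A B
  x-contribution A B =
    trans (sumMoves-single S P d mv (λ P' d' → + x P' d' * (absg P' d' ⊠ gfun P' d') A B)
            (λ P' d' ne → cong (λ n → + n * (absg P' d' ⊠ gfun P' d') A B) (atMove-off P d 1 P' d' ne)))
          (trans (cong (λ n → + n * (absg P d ⊠ gfun P d) A B) (atMove-at P d 1))
                 (ℤP.*-identityˡ ((absg P d ⊠ gfun P d) A B)))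

  twice-rest : ∀ {E} → E ∈ pts S → sumPts S (λ C → + y P d C * (+ 2 * δ C E)) ≡ + 2 * ind rest E
  twice-rest {E} E∈S = begin
      sumPts S (λ C → + y P d C * (+ 2 * δ C E))
    ≡⟨ sum-cong (pts S) (λ C _ → reassoc (+ y P d C) (δ C E)) ⟩
      sumPts S (λ C → (+ 2 * + y P d C) * δ C E)
    ≡⟨ sum-pick S (λ C → + 2 * + y P d C) E∈S ⟩
      + 2 * + y P d E
    ≡⟨ cong (λ n → + 2 * + n) (atMove-at P d (indℕ rest E)) ⟩
      + 2 * + indℕ rest E
    ≡⟨ cong (+ 2 *_) (+indℕ rest E) ⟩
      + 2 * ind rest E ∎
    where
    open ≡-Reasoning
    reassoc : ∀ u e → u * (+ 2 * e) ≡ (+ 2 * u) * e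
    reassoc = solve-∀

  y-contribution : ∀ A B → A ∈ pts S → B ∈ pts S →
    sumMoves S (λ P' d' → sumPts S (λ C → + y P' d' C * ((λ E → + 2 * δ C E) ⊠ gfun P' d') A B))
      ≡ ((λ E → + 2 * ind rest E) ⊠ gfun P d) A B
  y-contribution A B A∈S B∈S = begin
      sumMoves S (λ P' d' → sumPts S (λ C → + y P' d' C * ((λ E → + 2 * δ C E) ⊠ gfun P' d') A B))
    ≡⟨ sumMoves-single S P d mv
         (λ P' d' → sumPts S (λ C → + y P' d' C * ((λ E → + 2 * δ C E) ⊠ gfun P' d') A B))
         (λ P' d' ne → sum-zero (pts S) (All.universal
           (λ C → cong (λ n → + n * ((λ E → + 2 * δ C E) ⊠ gfun P' d') A B)
                       (atMove-off P d (indℕ rest C) P' d' ne)) (pts S))) ⟩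
      sumPts S (λ C → + y P d C * ((λ E → + 2 * δ C E) ⊠ gfun P d) A B)
    ≡⟨ ⊠-sumˡ (pts S) (λ C → + y P d C) (λ C E → + 2 * δ C E) (gfun P d) A B ⟩
      ((λ E → sumPts S (λ C → + y P d C * (+ 2 * δ C E))) ⊠ gfun P d) A B
    ≡⟨ ⊠-cong A B (twice-rest A∈S) (twice-rest B∈S) refl refl ⟩
      ((λ E → + 2 * ind rest E) ⊠ gfun P d) A B ∎
    where open ≡-Reasoning

  identity : ∀ A B → A ∈ pts S → B ∈ pts S →
    (ind K ⊠ ind K) A B - (ind K' ⊠ ind K') A B ≡ Combination S x y A B
  identity A B A∈S B∈S = begin
      (ind K ⊠ ind K) A B - (ind K' ⊠ ind K') A B
    ≡⟨ cong (_-_ ((ind K ⊠ ind K) A B)) (⊠-cong A B (K'≡K-g A A∈S) (K'≡K-g B B∈S) (K'≡K-g A A∈S) (K'≡K-g B B∈S)) ⟩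
      (ind K ⊠ ind K) A B - ((λ E → ind K E - gfun P d E) ⊠ (λ E → ind K E - gfun P d E)) A B
    ≡⟨ ⊠-square-difference (ind K) (gfun P d) A B ⟩
      ((λ E → + 2 * ind K E - gfun P d E) ⊠ gfun P d) A B
    ≡⟨ ⊠-cong A B (weight-split A) (weight-split B) refl refl ⟩
      ((λ E → absg P d E + + 2 * ind rest E) ⊠ gfun P d) A B
    ≡⟨ ⊠-+ˡ (absg P d) (λ E → + 2 * ind rest E) (gfun P d) A B ⟩
      (absg P d ⊠ gfun P d) A B + ((λ E → + 2 * ind rest E) ⊠ gfun P d) A B
    ≡⟨ sym (cong₂ _+_ (x-contribution A B) (y-contribution A B A∈S B∈S)) ⟩
      Combination S x y A B ∎
    where open ≡-Reasoning

  load-bound : ∀ A → A ∈ pts S → Load S x y A ≤ card S K - card S K'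
  load-bound A _ = ℤP.≤-trans (ℤP.≤-reflexive load-single)
    (ℤP.≤-trans (at-most-one (gfun P d A ≟ 0ℤ))
      (ℤP.≤-reflexive (sym (trans (card-difference S K K' (gfun P d) K'≡K-g) (sum-gfun S P d mv)))))
    where
    counted : Point → Dir → ℤ
    counted P' d' = if does (gfun P' d' A ≟ 0ℤ) then 0ℤ else + x P' d'
    counted-off : ∀ P' d' → ¬ (P' ≡ P × d' ≡ d) → counted P' d' ≡ 0ℤ
    counted-off P' d' ne with does (gfun P' d' A ≟ 0ℤ)
    ... | true  = refl
    ... | false = cong +_ (atMove-off P d 1 P' d' ne)
    load-single : Load S x y A ≡ + indℕ rest A + (if does (gfun P d A ≟ 0ℤ) then 0ℤ else + 1)
    load-single = cong₂ _+_
      (trans (sumMoves-single S P d mv (λ P' d' → + y P' d' A)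
               (λ P' d' ne → cong +_ (atMove-off P d (indℕ rest A) P' d' ne)))
             (cong +_ (atMove-at P d (indℕ rest A))))
      (trans (sumMoves-single S P d mv counted counted-off)
             (cong (λ n → if does (gfun P d A ≟ 0ℤ) then 0ℤ else + n) (atMove-at P d 1)))
    at-most-one : ∀ q → + indℕ rest A + (if does q then 0ℤ else + 1) ≤ 1ℤ
    at-most-one (yes _) with rest A
    ... | true  = ℤP.≤-refl
    ... | false = +≤+ ℕ.z≤n
    at-most-one (no g≢0) rewrite rest-off-support A g≢0 = ℤP.≤-refl

  certificate : Certificate S K K'
  certificate = record
    { x = x ; y = y ; y-support = y-support ; identity = identity ; load-bound = load-bound }

certificate-move : ∀ {S K K'} → LegalMove S K K' → Certificate S K K'
certificate-move {S} {K} {K'} (P , d , mv , KP , KQ , KR , _ , K'≡K-g) =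
  SingleMove.certificate S K K' P d mv KP KQ KR K'≡K-g

certificate : ∀ {S I J} → Reach S I J → Certificate S I J
certificate {S} {I} done        = certificate-refl S I
certificate         (step m ms) = certificate-trans (certificate-move m) (certificate ms)

proposition1 : (S : Board) (I J : Position) → I ⊆B S → J ⊆B S → Reach S I J →
    Σ (Point → Dir → ℕ) λ x → Σ (Point → Dir → Point → ℕ) λ y →
      (∀ P d A → IsMove S P d → A ∈ pts S → gfun P d A ≢ 0ℤ → y P d A ≡ 0) ×
      (∀ A B → A ∈ pts S → B ∈ pts S →
        (ind I ⊠ ind I) A B - (ind J ⊠ ind J) A B
          ≡ sumMoves S (λ P d → + x P d * (absg P d ⊠ gfun P d) A B)
            + sumMoves S (λ P d → sumPts S (λ C → + y P d C * ((λ E → + 2 * δ C E) ⊠ gfun P d) A B))) ×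
      (∀ A → A ∈ pts S →
        (0ℤ ≤ sumMoves S (λ P d → + y P d A) + sumMoves S (λ P d → if does (gfun P d A ≟ 0ℤ) then 0ℤ else + x P d))
        × (sumMoves S (λ P d → + y P d A) + sumMoves S (λ P d → if does (gfun P d A ≟ 0ℤ) then 0ℤ else + x P d)
            ≤ card S I - card S J))
proposition1 S I J _ _ path =
  x , y , y-support , identity , λ A A∈S → Load-nonneg S x y A , load-bound A A∈S
  where open Certificate (certificate path)
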